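{- Let $p$ be an odd prime and $n\in\mathbb N_0$ with $p$-adic expansion $n=\sum_{i\ge0}a_ip^i$, $a_i\in\{0,1,\ldots,p-1\}$. Let $C_n=\binom{2n}{n}-\binom{2n}{n-1}$ denote the $n$th Catalan number. (i) If $a_0\ne p-1$, then $C_n\not\equiv 0\pmod p$ if and only if $a_i\in\{0,1,\ldots,\lfloor (p-1)/2\rfloor\}$ for all $i\in\mathbb N_0$. (ii) If $a_0=p-1$, let $l\in\mathbb N$ be maximal such that $a_0=a_1=\cdots=a_{l-1}=p-1$, and set $n_l=\sum_{i\ge0}a_{i+l}p^i$. Then $C_n\equiv -(2n_l+1)C_{n_l}\pmod p$.
   Context: $\binom{2n}{ -1}=0$. -}

module Defs where

open import Data.Nat as ℕ using (ℕ; zero; suc; _^_; NonZero)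
open import Data.Nat.DivMod using (_/_; _%_)
open import Data.Nat.Properties using (m^n≢0)
open import Data.Nat.Combinatorics using (_C_)
open import Data.Integer as ℤ using (ℤ; +_)
open import Data.Integer.Divisibility using (_∣_)

-- binomial (2n choose n-1), with the convention (2n choose -1) = 0
binomPrev : ℕ → ℕ
binomPrev zero    = 0
binomPrev (suc m) = (2 ℕ.* suc m) C m

catalan : ℕ → ℤ
catalan n = + ((2 ℕ.* n) C n) ℤ.- + binomPrev n

-- n / p^l : the number with p-adic digits a_{i+l} (i.e. n_l in the paper)
shift : (p : ℕ) .{{_ : NonZero p}} → ℕ → ℕ → ℕ
shift p l n = _/_ n (p ^ l) {{m^n≢0 p l}}

digit : (p : ℕ) .{{_ : NonZero p}} → ℕ → ℕ → ℕ
digit p i n = shift p i n % p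

_≡_[mod_] : ℤ → ℤ → ℕ → Set
a ≡ b [mod p ] = (+ p) ∣ (a ℤ.- b)

-- Everything is read off base-p digits through Lucas's theorem. Since (n + 1) C_n = (2n choose n),
-- when p ∤ n + 1 (that is, a₀ ≠ p − 1) p divides C_n exactly when it divides (2n choose n), and by
-- Lucas this happens exactly when doubling some digit of n carries, i.e. some aᵢ > (p − 1)/2.
-- When a₀ = p − 1, (2n choose n) ≡ 0, so C_n ≡ −(2n choose n−1) ≡ −(2n₁+1 choose n₁); every further
-- digit p − 1 is stripped from (2m+1 choose m) without changing its residue, and finally
-- (2nₗ+1 choose nₗ) = (2nₗ + 1) C_{nₗ}.

module Submission where

open import Defs
open import Data.Nat using (ℕ; zero; suc; _+_; _*_; _∸_; _^_; _/_; _%_; _≤_; _<_; _<?_; NonZero; z≤n; s≤s; z<s; s<s; nonTrivial⇒n>1)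
open import Data.Nat.Properties
open import Data.Nat.Combinatorics using (_C_; nC1≡n; nCn≡1; k>n⇒nCk≡0; nCk+nC[k+1]≡[n+1]C[k+1])
open import Data.Nat.Tactic.RingSolver using (solve-∀)
open import Data.Nat.DivMod using (m/n*n≤m; m*n/n≡m; /-monoˡ-≤; m≡m%n+[m/n]*n; m%n<n; m/n<m; %-distribˡ-+; %-distribˡ-*; %-pred-≡0; m/n/o≡m/[n*o]; n/1≡n)
open import Data.Nat.Divisibility using (_∣_; _∤_; divides; _∣0; ∣-trans; n∣m*n; ∣m⇒∣m*n; >⇒∤; m%n≡0⇒n∣m; n∣m⇒m%n≡0)
open import Data.Nat.Induction using (<-rec)
open import Data.Nat.Primality using (Prime; euclidsLemma; prime⇒nonTrivial; ¬prime[0]; ¬prime[1])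
open import Data.Empty using (⊥-elim)
open import Data.Integer as ℤ using (+_)
open import Data.Integer.Divisibility as ℤD using ()
open import Data.Integer.Properties using ([+m]-[+n]≡m⊖n; ⊖-≥; neg-involutive; pos-*)
open import Data.Sum using (inj₁; inj₂)
open import Data.Product using (_×_; _,_)
open import Function.Base using (_∘_)
open import Function.Bundles using (_⇔_; mk⇔; Equivalence)
open import Relation.Nullary using (¬_; yes; no; contradiction)
open import Level using (0ℓ)
open import Relation.Binary.Bundles using (Setoid)
open import Relation.Binary.Structures using (IsEquivalence)
import Relation.Binary.Reasoning.Setoid as SetoidReasoning
open import Relation.Binary.PropositionalEquality

pascal : ∀ n k → suc n C suc k ≡ n C k + n C suc k
pascal n k = sym (nCk+nC[k+1]≡[n+1]C[k+1] n k)

[1+k]*[1+n]C[1+k]≡[1+n]*nCk : ∀ n k → suc k * (suc n C suc k) ≡ suc n * (n C k)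
[1+k]*[1+n]C[1+k]≡[1+n]*nCk n       zero    = trans (*-identityˡ _) (trans (nC1≡n (suc n)) (sym (*-identityʳ (suc n))))
[1+k]*[1+n]C[1+k]≡[1+n]*nCk zero    (suc k) = *-zeroʳ (suc (suc k))
[1+k]*[1+n]C[1+k]≡[1+n]*nCk (suc n) (suc k) = begin
  suc (suc k) * (suc (suc n) C suc (suc k))                    ≡⟨ cong (suc (suc k) *_) (pascal (suc n) (suc k)) ⟩
  suc (suc k) * (X + suc n C suc (suc k))                      ≡⟨ *-distribˡ-+ (suc (suc k)) X _ ⟩
  X + suc k * X + suc (suc k) * (suc n C suc (suc k))          ≡⟨ cong₂ (λ a b → X + a + b) ([1+k]*[1+n]C[1+k]≡[1+n]*nCk n k) ([1+k]*[1+n]C[1+k]≡[1+n]*nCk n (suc k)) ⟩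
  X + suc n * (n C k) + suc n * (n C suc k)                    ≡⟨ +-assoc X _ _ ⟩
  X + (suc n * (n C k) + suc n * (n C suc k))                  ≡⟨ cong (_+_ X) (sym (*-distribˡ-+ (suc n) (n C k) _)) ⟩
  X + suc n * (n C k + n C suc k)                              ≡⟨ cong (λ y → X + suc n * y) (sym (pascal n k)) ⟩
  X + suc n * X                                                ∎
  where
  open ≡-Reasoning
  X : ℕ
  X = suc n C suc k

[1+n]*binomPrev≡n*central : ∀ n → suc n * binomPrev n ≡ n * ((2 * n) C n)
[1+n]*binomPrev≡n*central zero    = refl
[1+n]*binomPrev≡n*central (suc s) = +-cancelʳ-≡ _ _ _ (begin
  suc (suc s) * a + suc s * a    ≡⟨ sym (*-distribʳ-+ a (suc (suc s)) (suc s)) ⟩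
  (suc (suc s) + suc s) * a      ≡⟨ cong (_* a) ([2+s]+[1+s]≡1+2[1+s] s) ⟩
  suc N * a                      ≡⟨ sym ([1+k]*[1+n]C[1+k]≡[1+n]*nCk N s) ⟩
  suc s * (suc N C suc s)        ≡⟨ cong (suc s *_) (pascal N s) ⟩
  suc s * (a + b)                ≡⟨ *-distribˡ-+ (suc s) a b ⟩
  suc s * a + suc s * b          ≡⟨ +-comm (suc s * a) _ ⟩
  suc s * b + suc s * a          ∎)
  where
  open ≡-Reasoning
  N a b : ℕ
  N = 2 * suc s
  a = N C s
  b = N C suc s
  [2+s]+[1+s]≡1+2[1+s] : ∀ s → suc (suc s) + suc s ≡ suc (2 * suc s)
  [2+s]+[1+s]≡1+2[1+s] = solve-∀

binomPrev≤central : ∀ n → binomPrev n ≤ (2 * n) C n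
binomPrev≤central n = *-cancelˡ-≤ (suc n) (begin
  suc n * binomPrev n    ≡⟨ [1+n]*binomPrev≡n*central n ⟩
  n * ((2 * n) C n)      ≤⟨ *-monoˡ-≤ _ (n≤1+n n) ⟩
  suc n * ((2 * n) C n)  ∎)
  where open ≤-Reasoning

-- The truncated subtraction is harmless by binomPrev≤central.
catalanℕ : ℕ → ℕ
catalanℕ n = (2 * n) C n ∸ binomPrev n

catalan≡+catalanℕ : ∀ n → catalan n ≡ + catalanℕ n
catalan≡+catalanℕ n = trans ([+m]-[+n]≡m⊖n ((2 * n) C n) (binomPrev n)) (⊖-≥ (binomPrev≤central n))

catalanℕ+binomPrev≡central : ∀ n → catalanℕ n + binomPrev n ≡ (2 * n) C n
catalanℕ+binomPrev≡central n = m∸n+n≡m (binomPrev≤central n)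

[1+n]*catalanℕ≡central : ∀ n → suc n * catalanℕ n ≡ (2 * n) C n
[1+n]*catalanℕ≡central n = begin
  suc n * (b ∸ binomPrev n)                ≡⟨ *-distribˡ-∸ (suc n) b (binomPrev n) ⟩
  suc n * b ∸ suc n * binomPrev n          ≡⟨ cong (suc n * b ∸_) ([1+n]*binomPrev≡n*central n) ⟩
  b + n * b ∸ n * b                        ≡⟨ m+n∸n≡m b (n * b) ⟩
  b                                        ∎
  where
  open ≡-Reasoning
  b : ℕ
  b = (2 * n) C n

oddCentral≡central+binomPrev : ∀ n → (2 * n + 1) C n ≡ (2 * n) C n + binomPrev n
oddCentral≡central+binomPrev zero    = refl
oddCentral≡central+binomPrev (suc s) = begin
  (2 * suc s + 1) C suc s               ≡⟨ cong (_C suc s) (+-comm (2 * suc s) 1) ⟩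
  suc (2 * suc s) C suc s               ≡⟨ pascal (2 * suc s) s ⟩
  binomPrev (suc s) + (2 * suc s) C suc s ≡⟨ +-comm (binomPrev (suc s)) _ ⟩
  (2 * suc s) C suc s + binomPrev (suc s) ∎
  where open ≡-Reasoning

[2n+1]*catalanℕ≡oddCentral : ∀ n → (2 * n + 1) * catalanℕ n ≡ (2 * n + 1) C n
[2n+1]*catalanℕ≡oddCentral n = begin
  (2 * n + 1) * (b ∸ a)                    ≡⟨ *-distribˡ-∸ (2 * n + 1) b a ⟩
  (2 * n + 1) * b ∸ (2 * n + 1) * a        ≡⟨ cong (_∸ (2 * n + 1) * a) expand ⟩
  b + a + (2 * n + 1) * a ∸ (2 * n + 1) * a ≡⟨ m+n∸n≡m (b + a) ((2 * n + 1) * a) ⟩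
  b + a                                    ≡⟨ sym (oddCentral≡central+binomPrev n) ⟩
  (2 * n + 1) C n                          ∎
  where
  open ≡-Reasoning
  b : ℕ
  b = (2 * n) C n
  a = binomPrev n
  split : ∀ n y → (2 * n + 1) * y ≡ y + 2 * (n * y)
  split = solve-∀
  regroup : ∀ n y z → y + 2 * (suc n * z) ≡ y + z + (2 * n + 1) * z
  regroup = solve-∀
  expand : (2 * n + 1) * b ≡ b + a + (2 * n + 1) * a
  expand = trans (split n b) (trans (cong (λ x → b + 2 * x) (sym ([1+n]*binomPrev≡n*central n))) (regroup n b a))

2[a+m*n]≡2a+2m*n : ∀ a m n → 2 * (a + m * n) ≡ 2 * a + (2 * m) * n
2[a+m*n]≡2a+2m*n = solve-∀

m≤n/2⇔2m<1+n : ∀ m n → m ≤ n / 2 ⇔ 2 * m < suc n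
m≤n/2⇔2m<1+n m n = mk⇔ to from
  where
  to : m ≤ n / 2 → 2 * m < suc n
  to m≤n/2 = s≤s (≤-trans (*-monoʳ-≤ 2 m≤n/2) (subst (_≤ n) (*-comm (n / 2) 2) (m/n*n≤m n 2)))
  from : 2 * m < suc n → m ≤ n / 2
  from (s≤s 2m≤n) = subst (_≤ n / 2) (trans (cong (_/ 2) (*-comm 2 m)) (m*n/n≡m m 2)) (/-monoˡ-≤ 2 2m≤n)

module Congruence (p : ℕ) .{{_ : NonZero p}} where

  -- A record rather than an equation between remainders, so that x and y can be inferred.
  infix 4 _≈_
  record _≈_ (x y : ℕ) : Set where
    constructor mk≈
    field %-≡ : x % p ≡ y % p

  ≈-isEquivalence : IsEquivalence _≈_
  ≈-isEquivalence = record
    { refl  = mk≈ refl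
    ; sym   = λ (mk≈ x≈y) → mk≈ (sym x≈y)
    ; trans = λ (mk≈ x≈y) (mk≈ y≈z) → mk≈ (trans x≈y y≈z)
    }

  ≈-setoid : Setoid 0ℓ 0ℓ
  ≈-setoid = record { isEquivalence = ≈-isEquivalence }

  module ≈-Reasoning = SetoidReasoning ≈-setoid

  open IsEquivalence ≈-isEquivalence public
    using () renaming (refl to ≈-refl; sym to ≈-sym; trans to ≈-trans)

  ≡⇒≈ : ∀ {x y} → x ≡ y → x ≈ y
  ≡⇒≈ x≡y = mk≈ (cong (_% p) x≡y)

  +-cong : ∀ {x x′ y y′} → x ≈ x′ → y ≈ y′ → x + y ≈ x′ + y′
  +-cong {x} {x′} {y} {y′} (mk≈ x≈x′) (mk≈ y≈y′) = mk≈ (begin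
    (x + y) % p              ≡⟨ %-distribˡ-+ x y p ⟩
    (x % p + y % p) % p      ≡⟨ cong₂ (λ a b → (a + b) % p) x≈x′ y≈y′ ⟩
    (x′ % p + y′ % p) % p    ≡⟨ %-distribˡ-+ x′ y′ p ⟨
    (x′ + y′) % p            ∎)
    where open ≡-Reasoning

  *-cong : ∀ {x x′ y y′} → x ≈ x′ → y ≈ y′ → x * y ≈ x′ * y′
  *-cong {x} {x′} {y} {y′} (mk≈ x≈x′) (mk≈ y≈y′) = mk≈ (begin
    (x * y) % p              ≡⟨ %-distribˡ-* x y p ⟩
    (x % p * (y % p)) % p    ≡⟨ cong₂ (λ a b → (a * b) % p) x≈x′ y≈y′ ⟩
    (x′ % p * (y′ % p)) % p  ≡⟨ %-distribˡ-* x′ y′ p ⟨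
    (x′ * y′) % p            ∎)
    where open ≡-Reasoning

  ∣⇒≈0 : ∀ {x} → p ∣ x → x ≈ 0
  ∣⇒≈0 {x} p∣x = mk≈ (trans (n∣m⇒m%n≡0 x p p∣x) (sym (n∣m⇒m%n≡0 0 p (p ∣0))))

  ≈0⇒∣ : ∀ {x} → x ≈ 0 → p ∣ x
  ≈0⇒∣ {x} (mk≈ x≈0) = m%n≡0⇒n∣m x p (trans x≈0 (n∣m⇒m%n≡0 0 p (p ∣0)))

module _ {p : ℕ} .{{_ : NonZero p}} where

  shift-zero : ∀ n → shift p 0 n ≡ n
  shift-zero n = n/1≡n n

  shift-suc : ∀ l n → shift p (suc l) n ≡ shift p l (n / p)
  shift-suc l n = sym (m/n/o≡m/[n*o] n p (p ^ l) {{_}} {{m^n≢0 p l}} {{m^n≢0 p (suc l)}})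

  digit-zero : ∀ n → digit p 0 n ≡ n % p
  digit-zero n = cong (_% p) (shift-zero n)

  digit-suc : ∀ i n → digit p (suc i) n ≡ digit p i (n / p)
  digit-suc i n = cong (_% p) (shift-suc i n)

  leading-digits-/ : ∀ {d l n} → (∀ i → i < suc l → digit p i n ≡ d) → ∀ i → i < l → digit p i (n / p) ≡ d
  leading-digits-/ {n = n} leading i i<l = trans (sym (digit-suc i n)) (leading (suc i) (s<s i<l))

module ModuloPrime {q : ℕ} (prime : Prime (suc q)) where

  p : ℕ
  p = suc q

  open Congruence p public

  1<p : 1 < p
  1<p = nonTrivial⇒n>1 p {{prime⇒nonTrivial prime}}

  p∣pC[1+k] : ∀ k → suc k < p → p ∣ p C suc k
  p∣pC[1+k] k 1+k<p with euclidsLemma (suc k) (p C suc k) prime (divides (q C k) [1+k]*pC[1+k]≡qCk*p)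
    where
    [1+k]*pC[1+k]≡qCk*p : suc k * (p C suc k) ≡ (q C k) * p
    [1+k]*pC[1+k]≡qCk*p = trans ([1+k]*[1+n]C[1+k]≡[1+n]*nCk q k) (*-comm p (q C k))
  ... | inj₁ p∣1+k     = contradiction p∣1+k (>⇒∤ 1+k<p)
  ... | inj₂ p∣pC[1+k] = p∣pC[1+k]

  p∤nCk : ∀ {n k} → k ≤ n → n < p → p ∤ n C k
  p∤nCk {k = zero}        _         _   = >⇒∤ 1<p
  p∤nCk {suc n} {suc k} (s≤s k≤n) n<p p∣C
    with euclidsLemma (suc n) (n C k) prime
           (subst (p ∣_) ([1+k]*[1+n]C[1+k]≡[1+n]*nCk n k) (∣-trans p∣C (n∣m*n (suc k))))
  ... | inj₁ p∣1+n = >⇒∤ n<p p∣1+n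
  ... | inj₂ p∣nCk = p∤nCk k≤n (≤-trans (n≤1+n (suc n)) n<p) p∣nCk

  -- Pascal's rule on N = a + m p and K = b + k p. When the last digit of N is 0, the
  -- borrow turns the digit coefficient into p C (b + 1), which p divides.
  lucas : ∀ m a k b → a < p → b < p → (a + m * p) C (b + k * p) ≈ (a C b) * (m C k)
  lucas m       a       zero    zero    _   _   = ≈-refl
  lucas zero    zero    (suc k) zero    _   _   = ≈-refl
  lucas zero    zero    k       (suc b) _   _   = ≈-refl
  lucas m       (suc a) k       (suc b) a<p b<p = begin
    suc N C suc K                          ≡⟨ pascal N K ⟩
    N C K + N C suc K                      ≈⟨ +-cong (lucas m a k b a<p′ (<-trans (n<1+n b) b<p)) (lucas m a k (suc b) a<p′ b<p) ⟩
    (a C b) * (m C k) + (a C suc b) * (m C k) ≡⟨ *-distribʳ-+ (m C k) (a C b) (a C suc b) ⟨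
    (a C b + a C suc b) * (m C k)          ≡⟨ cong (_* (m C k)) (pascal a b) ⟨
    (suc a C suc b) * (m C k)              ∎
    where
    open ≈-Reasoning
    N K : ℕ
    N = a + m * p
    K = b + k * p
    a<p′ : a < p
    a<p′ = <-trans (n<1+n a) a<p
  lucas m       (suc a) (suc k) zero    a<p _   = begin
    suc N C suc K                          ≡⟨ pascal N K ⟩
    N C K + N C suc K                      ≈⟨ +-cong (lucas m a k q a<p′ (n<1+n q)) (lucas m a (suc k) zero a<p′ 0<1+n) ⟩
    (a C q) * (m C k) + 1 * (m C suc k)    ≡⟨ cong (λ c → c * (m C k) + 1 * (m C suc k)) (k>n⇒nCk≡0 (≤-pred a<p)) ⟩
    1 * (m C suc k)                        ∎
    where
    open ≈-Reasoning
    N K : ℕ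
    N = a + m * p
    K = q + k * p
    a<p′ : a < p
    a<p′ = <-trans (n<1+n a) a<p
  lucas (suc m) zero    k       (suc b) _   b<p = begin
    suc N C suc K                          ≡⟨ pascal N K ⟩
    N C K + N C suc K                      ≈⟨ +-cong (lucas m q k b (n<1+n q) (<-trans (n<1+n b) b<p)) (lucas m q k (suc b) (n<1+n q) b<p) ⟩
    (q C b) * (m C k) + (q C suc b) * (m C k) ≡⟨ *-distribʳ-+ (m C k) (q C b) (q C suc b) ⟨
    (q C b + q C suc b) * (m C k)          ≡⟨ cong (_* (m C k)) (pascal q b) ⟨
    (p C suc b) * (m C k)                  ≈⟨ ∣⇒≈0 (∣m⇒∣m*n (m C k) (p∣pC[1+k] b b<p)) ⟩
    0                                      ∎
    where
    open ≈-Reasoning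
    N K : ℕ
    N = q + m * p
    K = b + k * p
  lucas (suc m) zero    (suc k) zero    _   _   = begin
    suc N C suc K                          ≡⟨ pascal N K ⟩
    N C K + N C suc K                      ≈⟨ +-cong (lucas m q k q (n<1+n q) (n<1+n q)) (lucas m q (suc k) zero (n<1+n q) 0<1+n) ⟩
    (q C q) * (m C k) + 1 * (m C suc k)    ≡⟨ cong₂ _+_ (trans (cong (_* (m C k)) (nCn≡1 q)) (*-identityˡ (m C k))) (*-identityˡ (m C suc k)) ⟩
    m C k + m C suc k                      ≡⟨ pascal m k ⟨
    suc m C suc k                          ≡⟨ *-identityˡ (suc m C suc k) ⟨
    1 * (suc m C suc k)                    ∎
    where
    open ≈-Reasoning
    N K : ℕ
    N = q + m * p
    K = q + k * p

  central≈central[a₀]*central[n/p] : ∀ n → 2 * (n % p) < p →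
    (2 * n) C n ≈ ((2 * (n % p)) C (n % p)) * ((2 * (n / p)) C (n / p))
  central≈central[a₀]*central[n/p] n 2a<p = begin
    (2 * n) C n                           ≡⟨ cong (λ x → (2 * x) C x) (m≡m%n+[m/n]*n n p) ⟩
    (2 * (a + m * p)) C (a + m * p)       ≡⟨ cong (_C (a + m * p)) (2[a+m*n]≡2a+2m*n a m p) ⟩
    (2 * a + (2 * m) * p) C (a + m * p)   ≈⟨ lucas (2 * m) (2 * a) m a 2a<p (m%n<n n p) ⟩
    ((2 * a) C a) * ((2 * m) C m)         ∎
    where
    open ≈-Reasoning
    a m : ℕ
    a = n % p
    m = n / p

  -- Doubling a₀ carries: 2n = (2a₀ − p) + (2m + 1) p, and the new last digit is below a₀.
  p≤2a₀⇒central≈0 : ∀ n → p ≤ 2 * (n % p) → (2 * n) C n ≈ 0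
  p≤2a₀⇒central≈0 n p≤2a = begin
    (2 * n) C n                           ≡⟨ cong (λ x → (2 * x) C x) (m≡m%n+[m/n]*n n p) ⟩
    (2 * (a + m * p)) C (a + m * p)       ≡⟨ cong (_C (a + m * p)) 2[a+mp]≡c+[1+2m]p ⟩
    (c + suc (2 * m) * p) C (a + m * p)   ≈⟨ lucas (suc (2 * m)) c m a (<-trans c<a a<p) a<p ⟩
    (c C a) * (suc (2 * m) C m)           ≡⟨ cong (_* (suc (2 * m) C m)) (k>n⇒nCk≡0 c<a) ⟩
    0                                     ∎
    where
    open ≈-Reasoning
    a m : ℕ
    a = n % p
    m = n / p
    c : ℕ
    c = 2 * a ∸ p
    a<p : a < p
    a<p = m%n<n n p
    c+p≡a+a : c + p ≡ a + a
    c+p≡a+a = trans (m∸n+n≡m p≤2a) (cong (_+_ a) (+-identityʳ a))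
    c<a : c < a
    c<a = +-cancelʳ-< p c a (subst (_< a + p) (sym c+p≡a+a) (+-monoʳ-< a a<p))
    2[a+mp]≡c+[1+2m]p : 2 * (a + m * p) ≡ c + suc (2 * m) * p
    2[a+mp]≡c+[1+2m]p = trans (2[a+m*n]≡2a+2m*n a m p)
      (trans (cong (_+ (2 * m) * p) (sym (m∸n+n≡m p≤2a))) (+-assoc c p ((2 * m) * p)))

  large-digit⇒central≈0 : ∀ i n → p ≤ 2 * digit p i n → (2 * n) C n ≈ 0
  large-digit⇒central≈0 i n large with 2 * (n % p) <? p
  large-digit⇒central≈0 i       n large | no  ¬low = p≤2a₀⇒central≈0 n (≮⇒≥ ¬low)
  large-digit⇒central≈0 zero    n large | yes low  =
    contradiction (subst (λ d → p ≤ 2 * d) (digit-zero n) large) (<⇒≱ low)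
  large-digit⇒central≈0 (suc i) n large | yes low  = begin
    (2 * n) C n                                    ≈⟨ central≈central[a₀]*central[n/p] n low ⟩
    ((2 * (n % p)) C (n % p)) * ((2 * m) C m)      ≈⟨ *-cong (≈-refl {(2 * (n % p)) C (n % p)}) (large-digit⇒central≈0 i m large′) ⟩
    ((2 * (n % p)) C (n % p)) * 0                  ≡⟨ *-zeroʳ ((2 * (n % p)) C (n % p)) ⟩
    0                                              ∎
    where
    open ≈-Reasoning
    m : ℕ
    m = n / p
    large′ : p ≤ 2 * digit p i m
    large′ = subst (λ d → p ≤ 2 * d) (digit-suc i n) large

  p∣central⇒p∣central[n/p] : ∀ n → 2 * (n % p) < p → p ∣ (2 * n) C n → p ∣ (2 * (n / p)) C (n / p)
  p∣central⇒p∣central[n/p] n low p∣central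
    with euclidsLemma ((2 * (n % p)) C (n % p)) _ prime
           (≈0⇒∣ (≈-trans (≈-sym (central≈central[a₀]*central[n/p] n low)) (∣⇒≈0 p∣central)))
  ... | inj₁ p∣low  = contradiction p∣low (p∤nCk (m≤m+n (n % p) (n % p + 0)) low)
  ... | inj₂ p∣high = p∣high

  small-digits⇒p∤central : ∀ n → (∀ i → 2 * digit p i n < p) → p ∤ (2 * n) C n
  small-digits⇒p∤central = <-rec _ step
    where
    step : ∀ n → (∀ {m} → m < n → (∀ i → 2 * digit p i m < p) → p ∤ (2 * m) C m) →
           (∀ i → 2 * digit p i n < p) → p ∤ (2 * n) C n
    step zero      _   _     = p∤nCk z≤n 0<1+n
    step n@(suc _) rec small = rec (m/n<m n p 1<p) small′ ∘ p∣central⇒p∣central[n/p] n low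
      where
      low : 2 * (n % p) < p
      low = subst (λ d → 2 * d < p) (digit-zero n) (small 0)
      small′ : ∀ i → 2 * digit p i (n / p) < p
      small′ i = subst (λ d → 2 * d < p) (digit-suc i n) (small (suc i))

  p∤1+n : ∀ n → digit p 0 n ≢ q → p ∤ suc n
  p∤1+n n a₀≢q p∣1+n = a₀≢q (trans (digit-zero n) (%-pred-≡0 (n∣m⇒m%n≡0 (suc n) p p∣1+n)))

  p∤catalanℕ⇔small-digits : ∀ n → digit p 0 n ≢ q → p ∤ catalanℕ n ⇔ (∀ i → digit p i n ≤ q / 2)
  p∤catalanℕ⇔small-digits n a₀≢q = mk⇔ p∤⇒small small⇒p∤
    where
    open Equivalence
    p∣central⇒p∣catalanℕ : p ∣ (2 * n) C n → p ∣ catalanℕ n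
    p∣central⇒p∣catalanℕ p∣central
      with euclidsLemma (suc n) (catalanℕ n) prime (subst (p ∣_) (sym ([1+n]*catalanℕ≡central n)) p∣central)
    ... | inj₁ p∣1+n = contradiction p∣1+n (p∤1+n n a₀≢q)
    ... | inj₂ p∣cat = p∣cat
    p∤⇒small : p ∤ catalanℕ n → ∀ i → digit p i n ≤ q / 2
    p∤⇒small p∤cat i with 2 * digit p i n <? p
    ... | yes small = from (m≤n/2⇔2m<1+n _ q) small
    ... | no  large = contradiction (p∣central⇒p∣catalanℕ (≈0⇒∣ (large-digit⇒central≈0 i n (≮⇒≥ large)))) p∤cat
    small⇒p∤ : (∀ i → digit p i n ≤ q / 2) → p ∤ catalanℕ n
    small⇒p∤ small p∣cat = small-digits⇒p∤central n (λ i → to (m≤n/2⇔2m<1+n _ q) (small i))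
      (subst (p ∣_) ([1+n]*catalanℕ≡central n) (∣-trans p∣cat (n∣m*n (suc n))))

module _ {r : ℕ} (prime : Prime (suc (suc r))) where

  open ModuloPrime prime

  n≡q+[n/p]*p : ∀ n → n % p ≡ suc r → n ≡ suc r + (n / p) * p
  n≡q+[n/p]*p n a₀≡q = trans (m≡m%n+[m/n]*n n p) (cong (_+ (n / p) * p) a₀≡q)

  binomPrev≈oddCentral[n/p] : ∀ n → n % p ≡ suc r → binomPrev n ≈ (2 * (n / p) + 1) C (n / p)
  binomPrev≈oddCentral[n/p] n a₀≡q = begin
    binomPrev n                            ≡⟨ cong binomPrev (n≡q+[n/p]*p n a₀≡q) ⟩
    (2 * suc (r + m * p)) C (r + m * p)    ≡⟨ cong (_C (r + m * p)) (2[1+r+mp]≡r+[1+2m]p r m) ⟩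
    (r + suc (2 * m) * p) C (r + m * p)    ≈⟨ lucas (suc (2 * m)) r m r r<p r<p ⟩
    (r C r) * (suc (2 * m) C m)            ≡⟨ trans (cong (_* (suc (2 * m) C m)) (nCn≡1 r)) (*-identityˡ _) ⟩
    suc (2 * m) C m                        ≡⟨ cong (_C m) (+-comm 1 (2 * m)) ⟩
    (2 * m + 1) C m                        ∎
    where
    open ≈-Reasoning
    m : ℕ
    m = n / p
    r<p : r < p
    r<p = n≤1+n (suc r)
    2[1+r+mp]≡r+[1+2m]p : ∀ r m → 2 * suc (r + m * suc (suc r)) ≡ r + suc (2 * m) * suc (suc r)
    2[1+r+mp]≡r+[1+2m]p = solve-∀

  oddCentral≈oddCentral[n/p] : ∀ n → n % p ≡ suc r → (2 * n + 1) C n ≈ (2 * (n / p) + 1) C (n / p)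
  oddCentral≈oddCentral[n/p] n a₀≡q = begin
    (2 * n + 1) C n                                  ≡⟨ cong (λ x → (2 * x + 1) C x) (n≡q+[n/p]*p n a₀≡q) ⟩
    (2 * (suc r + m * p) + 1) C (suc r + m * p)      ≡⟨ cong (_C (suc r + m * p)) (2[q+mp]+1≡q+[2m+1]p r m) ⟩
    (suc r + (2 * m + 1) * p) C (suc r + m * p)      ≈⟨ lucas (2 * m + 1) (suc r) m (suc r) (n<1+n _) (n<1+n _) ⟩
    (suc r C suc r) * ((2 * m + 1) C m)              ≡⟨ trans (cong (_* ((2 * m + 1) C m)) (nCn≡1 (suc r))) (*-identityˡ _) ⟩
    (2 * m + 1) C m                                  ∎
    where
    open ≈-Reasoning
    m : ℕ
    m = n / p
    2[q+mp]+1≡q+[2m+1]p : ∀ r m → 2 * (suc r + m * suc (suc r)) + 1 ≡ suc r + (2 * m + 1) * suc (suc r)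
    2[q+mp]+1≡q+[2m+1]p = solve-∀

  oddCentral≈oddCentral[shift] : ∀ l n → (∀ i → i < l → digit p i n ≡ suc r) →
    (2 * n + 1) C n ≈ (2 * shift p l n + 1) C shift p l n
  oddCentral≈oddCentral[shift] zero    n _   = ≡⇒≈ (cong (λ x → (2 * x + 1) C x) (sym (shift-zero {p} n)))
  oddCentral≈oddCentral[shift] (suc l) n leading = begin
    (2 * n + 1) C n                                  ≈⟨ oddCentral≈oddCentral[n/p] n (trans (sym (digit-zero n)) (leading 0 z<s)) ⟩
    (2 * (n / p) + 1) C (n / p)                      ≈⟨ oddCentral≈oddCentral[shift] l (n / p) (leading-digits-/ leading) ⟩
    (2 * shift p l (n / p) + 1) C shift p l (n / p)  ≡⟨ cong (λ x → (2 * x + 1) C x) (shift-suc l n) ⟨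
    (2 * shift p (suc l) n + 1) C shift p (suc l) n  ∎
    where
    open ≈-Reasoning

  p∣catalanℕ+[2nₗ+1]catalanℕ : ∀ n l → 1 ≤ l → (∀ i → i < l → digit p i n ≡ suc r) →
    p ∣ catalanℕ n + (2 * shift p l n + 1) * catalanℕ (shift p l n)
  p∣catalanℕ+[2nₗ+1]catalanℕ n (suc l) _ leading = ≈0⇒∣ (begin
    catalanℕ n + (2 * nₗ + 1) * catalanℕ nₗ    ≡⟨ cong (_+_ (catalanℕ n)) ([2n+1]*catalanℕ≡oddCentral nₗ) ⟩
    catalanℕ n + (2 * nₗ + 1) C nₗ             ≈⟨ +-cong (≈-refl {catalanℕ n}) (≈-sym binomPrev≈) ⟩
    catalanℕ n + binomPrev n                   ≡⟨ catalanℕ+binomPrev≡central n ⟩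
    (2 * n) C n                                ≈⟨ p≤2a₀⇒central≈0 n (subst (λ a → p ≤ 2 * a) (sym a₀≡q) p≤2q) ⟩
    0                                          ∎)
    where
    open ≈-Reasoning
    nₗ : ℕ
    nₗ = shift p (suc l) n
    a₀≡q : n % p ≡ suc r
    a₀≡q = trans (sym (digit-zero n)) (leading 0 z<s)
    p≤2q : p ≤ 2 * suc r
    p≤2q = s≤s (subst (suc r ≤_) (sym (+-suc r (r + 0))) (s≤s (m≤m+n r (r + 0))))
    binomPrev≈ : binomPrev n ≈ (2 * nₗ + 1) C nₗ
    binomPrev≈ = begin
      binomPrev n                                      ≈⟨ binomPrev≈oddCentral[n/p] n a₀≡q ⟩
      (2 * (n / p) + 1) C (n / p)                      ≈⟨ oddCentral≈oddCentral[shift] l (n / p) (leading-digits-/ leading) ⟩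
      (2 * shift p l (n / p) + 1) C shift p l (n / p)  ≡⟨ cong (λ x → (2 * x + 1) C x) (shift-suc l n) ⟨
      (2 * nₗ + 1) C nₗ                                ∎

∣catalan⇔∣catalanℕ : ∀ d n → (+ d) ℤD.∣ catalan n ⇔ d ∣ catalanℕ n
∣catalan⇔∣catalanℕ d n = mk⇔ (subst (λ z → d ∣ ℤ.∣ z ∣) (catalan≡+catalanℕ n))
                              (subst (λ z → d ∣ ℤ.∣ z ∣) (sym (catalan≡+catalanℕ n)))

catalan-congruence : ∀ d n m → d ∣ catalanℕ n + (2 * m + 1) * catalanℕ m →
  catalan n ≡ ℤ.- ((+ (2 * m + 1)) ℤ.* catalan m) [mod d ]
catalan-congruence d n m = subst (λ z → d ∣ ℤ.∣ z ∣) (sym (begin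
  catalan n ℤ.- ℤ.- (+ (2 * m + 1) ℤ.* catalan m)
    ≡⟨ cong₂ (λ x y → x ℤ.- ℤ.- (+ (2 * m + 1) ℤ.* y)) (catalan≡+catalanℕ n) (catalan≡+catalanℕ m) ⟩
  + catalanℕ n ℤ.+ ℤ.- ℤ.- (+ (2 * m + 1) ℤ.* + catalanℕ m)
    ≡⟨ cong (ℤ._+_ (+ catalanℕ n)) (neg-involutive (+ (2 * m + 1) ℤ.* + catalanℕ m)) ⟩
  + catalanℕ n ℤ.+ + (2 * m + 1) ℤ.* + catalanℕ m
    ≡⟨ cong (ℤ._+_ (+ catalanℕ n)) (pos-* (2 * m + 1) (catalanℕ m)) ⟨
  + (catalanℕ n + (2 * m + 1) * catalanℕ m)      ∎))
  where open ≡-Reasoning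

lemma5 : (p : ℕ) → .{{_ : NonZero p}} → Prime p → p ≢ 2 → (n : ℕ) →
  (digit p 0 n ≢ p ∸ 1 →
    ((¬ ((+ p) ℤD.∣ catalan n)) ⇔ (∀ i → digit p i n ≤ (p ∸ 1) / 2)))
  × (digit p 0 n ≡ p ∸ 1 → (l : ℕ) → 1 ≤ l →
    (∀ i → i < l → digit p i n ≡ p ∸ 1) → digit p l n ≢ p ∸ 1 →
    catalan n ≡ ℤ.- ((+ (2 * (shift p l n) + 1)) ℤ.* catalan (shift p l n)) [mod p ])
lemma5 zero          prime[p] _ _ = ⊥-elim (¬prime[0] prime[p])
lemma5 (suc zero)    prime[p] _ _ = ⊥-elim (¬prime[1] prime[p])
lemma5 (suc (suc r)) prime[p] _ n =
    (λ a₀≢q → mk⇔ (λ p∤ → to (small⇔ a₀≢q) (p∤ ∘ from ℤ∣⇔∣))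
                  (λ small → from (small⇔ a₀≢q) small ∘ to ℤ∣⇔∣))
  , λ _ l 1≤l leading _ →
      catalan-congruence p n (shift p l n) (p∣catalanℕ+[2nₗ+1]catalanℕ prime[p] n l 1≤l leading)
  where
  open Equivalence
  p : ℕ
  p = suc (suc r)
  small⇔ : digit p 0 n ≢ suc r → p ∤ catalanℕ n ⇔ (∀ i → digit p i n ≤ suc r / 2)
  small⇔ = ModuloPrime.p∤catalanℕ⇔small-digits prime[p] n
  ℤ∣⇔∣ : (+ p) ℤD.∣ catalan n ⇔ p ∣ catalanℕ n
  ℤ∣⇔∣ = ∣catalan⇔∣catalanℕ p n
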